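{- Let $s\ge 1$, $L\ge 2s^3+5s^2+1$, $L\le k\le s+L$ and $n\ge 2s^5+8s^4+s^3-14s^2+3s+1$ be integers, and write $k=rs+t$ with integers $r$ and $0\le t\le s-1$. There is an injection $\phi_1:C^1_{L,s,2}(n)\to F^1_{L,s,k}(n)$.
   Context: $C_{L,s,2}(n)$ is the set of partitions of $n$ with all parts in $\{s+1,\ldots,s+L\}$; for such a partition, $f_i$ denotes the number of parts equal to $i$. $F_{L,s,k}(n)$ is the set of partitions of $n$ with smallest part equal to $s$, largest part at most $s+L$, and no part equal to $k$; for such a partition, $g_i$ denotes the number of parts equal to $i$ (so $g_s\ge 1$, $g_k=0$). $C^1_{L,s,2}(n)$ is the set of partitions in $C_{L,s,2}(n)$ with $f_k=0$ and such that there exists an integer $a\ge 2$ with $f_{as}\ge 1$. $F^1_{L,s,k}(n)$ is the set of partitions in $F_{L,s,k}(n)$ with $r+1\ge g_s\ge 2$ and $g_{is}=0$ for all integers $2\le i<g_s$. -}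

module Defs where

open import Data.Nat using (ℕ; zero; suc; _+_; _*_; _≤_; _<_; _≥_)
open import Data.Nat.Properties using (_≟_)
open import Data.List using (List; []; _∷_)
open import Data.Nat.ListAction using (sum)
open import Data.List.Relation.Unary.All using (All)
open import Data.List.Relation.Unary.Linked using (Linked)
open import Data.Product using (Σ; ∃; _×_)
open import Relation.Nullary using (yes; no)
open import Relation.Binary.PropositionalEquality using (_≡_)

-- A partition is represented as a list of its parts in nonincreasing order.
-- (Parts are positive in all sets below since they are bounded below by s ≥ 1.)

mult : ℕ → List ℕ → ℕ
mult i [] = 0
mult i (x ∷ xs) with x ≟ i
... | yes _ = suc (mult i xs)
... | no  _ = mult i xs

IsPartitionOf : ℕ → List ℕ → Set
IsPartitionOf n xs = Linked _≥_ xs × sum xs ≡ n × All (λ x → 1 ≤ x) xs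

InC : (L s n : ℕ) → List ℕ → Set
InC L s n xs = IsPartitionOf n xs × All (λ x → s + 1 ≤ x × x ≤ s + L) xs

-- C^1_{L,s,2}(n) (with parameter k): f_k = 0 and ∃ a ≥ 2 with f_{a s} ≥ 1
InC1 : (L s k n : ℕ) → List ℕ → Set
InC1 L s k n xs =
  InC L s n xs × mult k xs ≡ 0 × (Σ ℕ λ a → 2 ≤ a × 1 ≤ mult (a * s) xs)

InF : (L s k n : ℕ) → List ℕ → Set
InF L s k n xs =
  IsPartitionOf n xs × 1 ≤ mult s xs × All (λ x → s ≤ x × x ≤ s + L) xs
  × mult k xs ≡ 0

-- F^1_{L,s,k}(n) (with parameter r): r+1 ≥ g_s ≥ 2 and g_{is} = 0 for 2 ≤ i < g_s
InF1 : (L s k r n : ℕ) → List ℕ → Set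
InF1 L s k r n xs =
  InF L s k n xs × mult s xs ≤ r + 1 × 2 ≤ mult s xs
  × (∀ i → 2 ≤ i → i < mult s xs → mult (i * s) xs ≡ 0)

C1 : (L s k n : ℕ) → Set
C1 L s k n = Σ (List ℕ) (InC1 L s k n)

F1 : (L s k r n : ℕ) → Set
F1 L s k r n = Σ (List ℕ) (InF1 L s k r n)

-- Let λ ∈ C¹ and let b ≥ 2 be the LEAST integer such that b·s is a
-- part of λ.  The image φ₁(λ) is obtained by removing one part b·s and
-- appending b parts equal to s ("trading" b·s for b copies of s).  Since
-- every part of λ exceeds s, the new partition has exactly g_s = b parts
-- equal to s, so it has smallest part s; minimality of b says g_{is} = 0 for
-- 2 ≤ i < g_s; and b·s ≤ s + L ≤ s + k < (r+2)·s gives g_s ≤ r + 1.  The map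
-- is injective because b = g_s can be read off the image, after which the
-- trade is undone by deleting the copies of s and restoring the part b·s.
module Submission where

open import Defs
open import Data.Nat using (ℕ; zero; suc; _+_; _*_; _^_; _≤_; _<_; _≥_; z≤n; s≤s; _≤?_)
open import Data.Nat.Properties
open import Data.Nat.ListAction using (sum)
open import Data.Nat.ListAction.Properties using (sum-++)
open import Data.List using (List; []; _∷_; _++_; replicate)
open import Data.List.Properties using (++-cancelʳ; ∷-injectiveˡ; ∷-injectiveʳ)
open import Data.List.Membership.Propositional using (_∈_)
open import Data.List.Relation.Unary.Any using (here; there)
open import Data.List.Relation.Unary.All as All using (All; []; _∷_)
open import Data.List.Relation.Unary.All.Properties using (++⁺; replicate⁺)
open import Data.List.Relation.Unary.Linked as Linked using (Linked; []; [-]; _∷_)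
open import Data.Product using (Σ; proj₁; proj₂; _,_; _×_)
open import Data.Empty using (⊥-elim)
open import Relation.Nullary using (yes; no; ¬_)
open import Relation.Nullary.Decidable using (_×-dec_)
open import Level using (0ℓ)
open import Relation.Unary using (Pred; Decidable)
open import Data.Nat.Induction using (<-rec)
open import Relation.Binary.PropositionalEquality

mult-++ : ∀ m xs ys → mult m (xs ++ ys) ≡ mult m xs + mult m ys
mult-++ m [] ys = refl
mult-++ m (x ∷ xs) ys with x ≟ m
... | yes _ = cong suc (mult-++ m xs ys)
... | no _ = mult-++ m xs ys

mult-replicate-self : ∀ a x → mult x (replicate a x) ≡ a
mult-replicate-self zero x = refl
mult-replicate-self (suc a) x with x ≟ x
... | yes _ = cong suc (mult-replicate-self a x)
... | no x≢x = ⊥-elim (x≢x refl)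

mult-replicate-other : ∀ a {x m} → x ≢ m → mult m (replicate a x) ≡ 0
mult-replicate-other zero x≢m = refl
mult-replicate-other (suc a) {x} {m} x≢m with x ≟ m
... | yes x≡m = ⊥-elim (x≢m x≡m)
... | no _ = mult-replicate-other a x≢m

mult-absent : ∀ m xs → All (_≢ m) xs → mult m xs ≡ 0
mult-absent m [] [] = refl
mult-absent m (x ∷ xs) (x≢m ∷ rest) with x ≟ m
... | yes x≡m = ⊥-elim (x≢m x≡m)
... | no _ = mult-absent m xs rest

mult-pos⇒∈ : ∀ m xs → 1 ≤ mult m xs → m ∈ xs
mult-pos⇒∈ m (x ∷ xs) pos with x ≟ m
... | yes refl = here refl
... | no _ = there (mult-pos⇒∈ m xs pos)

removeOne : ℕ → List ℕ → List ℕ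
removeOne d [] = []
removeOne d (x ∷ xs) with x ≟ d
... | yes _ = xs
... | no _ = x ∷ removeOne d xs

mult-removeOne-≤ : ∀ m d xs → mult m (removeOne d xs) ≤ mult m xs
mult-removeOne-≤ m d [] = z≤n
mult-removeOne-≤ m d (x ∷ xs) with x ≟ d
mult-removeOne-≤ m d (x ∷ xs) | yes _ with x ≟ m
... | yes _ = n≤1+n _
... | no _ = ≤-refl
mult-removeOne-≤ m d (x ∷ xs) | no _ with x ≟ m
... | yes _ = s≤s (mult-removeOne-≤ m d xs)
... | no _ = mult-removeOne-≤ m d xs

mult-removeOne-absent : ∀ m d xs → mult m xs ≡ 0 → mult m (removeOne d xs) ≡ 0
mult-removeOne-absent m d xs absent =
  n≤0⇒n≡0 (≤-trans (mult-removeOne-≤ m d xs) (≤-reflexive absent))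

removeOne-All : ∀ {P : Pred ℕ 0ℓ} d xs → All P xs → All P (removeOne d xs)
removeOne-All d [] [] = []
removeOne-All d (x ∷ xs) (px ∷ pxs) with x ≟ d
... | yes _ = pxs
... | no _ = px ∷ removeOne-All d xs pxs

sum-removeOne : ∀ d xs → 1 ≤ mult d xs → sum (removeOne d xs) + d ≡ sum xs
sum-removeOne d (x ∷ xs) pos with x ≟ d
... | yes refl = +-comm (sum xs) x
... | no _ = trans (+-assoc x (sum (removeOne d xs)) d) (cong (x +_) (sum-removeOne d xs pos))

Descending : List ℕ → Set
Descending = Linked _≥_

descending-head-bound : ∀ {x} xs → Descending (x ∷ xs) → All (_≤ x) xs
descending-head-bound [] _ = []
descending-head-bound (y ∷ ys) (y≤x ∷ rest) =
  y≤x ∷ All.map (λ z≤y → ≤-trans z≤y y≤x) (descending-head-bound ys rest)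

descending-cons : ∀ {x} xs → All (_≤ x) xs → Descending xs → Descending (x ∷ xs)
descending-cons [] _ _ = [-]
descending-cons (y ∷ ys) (y≤x ∷ _) desc = y≤x ∷ desc

removeOne-descending : ∀ d xs → Descending xs → Descending (removeOne d xs)
removeOne-descending d [] desc = desc
removeOne-descending d (x ∷ xs) desc with x ≟ d
... | yes _ = Linked.tail desc
... | no _ = descending-cons (removeOne d xs)
               (removeOne-All d xs (descending-head-bound xs desc))
               (removeOne-descending d xs (Linked.tail desc))

-- In nonincreasing lists the first occurrence of d is determined by the
-- remaining entries, so removing it is injective on lists containing d.
removeOne-injective : ∀ d xs ys → Descending xs → Descending ys
  → 1 ≤ mult d xs → 1 ≤ mult d ys → removeOne d xs ≡ removeOne d ys → xs ≡ ys
removeOne-injective d (x ∷ xs) (y ∷ ys) dx dy px py eq with x ≟ d | y ≟ d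
... | yes refl | yes refl = cong (x ∷_) eq
... | yes refl | no y≢d = ⊥-elim (y≢d (≤-antisym
        (All.head (subst (All (_≤ x)) eq (descending-head-bound xs dx)))
        (All.lookup (descending-head-bound ys dy) (mult-pos⇒∈ x ys py))))
... | no x≢d | yes refl = ⊥-elim (x≢d (≤-antisym
        (All.head (subst (All (_≤ y)) (sym eq) (descending-head-bound ys dy)))
        (All.lookup (descending-head-bound xs dx) (mult-pos⇒∈ y xs px))))
... | no _ | no _ = cong₂ _∷_ (∷-injectiveˡ eq)
        (removeOne-injective d xs ys (Linked.tail dx) (Linked.tail dy) px py (∷-injectiveʳ eq))

replicate-descending : ∀ a x → Descending (replicate a x)
replicate-descending zero x = []
replicate-descending (suc zero) x = [-]
replicate-descending (suc (suc a)) x = ≤-refl ∷ replicate-descending (suc a) x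

++-replicate-descending : ∀ a s xs → Descending xs → All (s ≤_) xs
  → Descending (xs ++ replicate a s)
++-replicate-descending a s [] _ [] = replicate-descending a s
++-replicate-descending a s (x ∷ xs) desc (s≤x ∷ bounds) =
  descending-cons (xs ++ replicate a s)
    (++⁺ (descending-head-bound xs desc) (replicate⁺ a s≤x))
    (++-replicate-descending a s xs (Linked.tail desc) bounds)

trade : (s b : ℕ) → List ℕ → List ℕ
trade s b xs = removeOne (b * s) xs ++ replicate b s

trade-sum : ∀ s b xs → 1 ≤ mult (b * s) xs → sum (trade s b xs) ≡ sum xs
trade-sum s b xs pos = begin
  sum (removeOne (b * s) xs ++ replicate b s)       ≡⟨ sum-++ (removeOne (b * s) xs) (replicate b s) ⟩
  sum (removeOne (b * s) xs) + sum (replicate b s)  ≡⟨ cong (sum (removeOne (b * s) xs) +_) (sum-replicate b s) ⟩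
  sum (removeOne (b * s) xs) + b * s                ≡⟨ sum-removeOne (b * s) xs pos ⟩
  sum xs                                            ∎
  where
  open ≡-Reasoning
  sum-replicate : ∀ a x → sum (replicate a x) ≡ a * x
  sum-replicate zero x = refl
  sum-replicate (suc a) x = cong (x +_) (sum-replicate a x)

trade-mult-self : ∀ s b xs → mult s xs ≡ 0 → mult s (trade s b xs) ≡ b
trade-mult-self s b xs absent = trans (mult-++ s (removeOne (b * s) xs) (replicate b s))
  (cong₂ _+_ (mult-removeOne-absent s (b * s) xs absent) (mult-replicate-self b s))

trade-mult-other : ∀ s b m xs → s ≢ m → mult m xs ≡ 0 → mult m (trade s b xs) ≡ 0
trade-mult-other s b m xs s≢m absent = trans (mult-++ m (removeOne (b * s) xs) (replicate b s))
  (cong₂ _+_ (mult-removeOne-absent m (b * s) xs absent) (mult-replicate-other b s≢m))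

trade-All : ∀ {P : Pred ℕ 0ℓ} s b xs → All P xs → P s → All P (trade s b xs)
trade-All s b xs pxs ps = ++⁺ (removeOne-All (b * s) xs pxs) (replicate⁺ b ps)

trade-descending : ∀ s b xs → Descending xs → All (s ≤_) xs → Descending (trade s b xs)
trade-descending s b xs desc bounds =
  ++-replicate-descending b s (removeOne (b * s) xs) (removeOne-descending (b * s) xs desc)
    (removeOne-All (b * s) xs bounds)

-- A trade on a list without parts s is undone knowing only its result: b is
-- the number of parts s, and then the list before the trade is determined.
trade-injective : ∀ s b c xs ys → mult s xs ≡ 0 → mult s ys ≡ 0
  → Descending xs → Descending ys → 1 ≤ mult (b * s) xs → 1 ≤ mult (c * s) ys
  → trade s b xs ≡ trade s c ys → xs ≡ ys
trade-injective s b c xs ys absx absy dx dy px py eq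
  with trans (sym (trade-mult-self s b xs absx)) (trans (cong (mult s) eq) (trade-mult-self s c ys absy))
... | refl = removeOne-injective (b * s) xs ys dx dy px py
               (++-cancelʳ (replicate b s) (removeOne (b * s) xs) (removeOne (b * s) ys) eq)

Least : Pred ℕ 0ℓ → Set
Least P = Σ ℕ λ b → P b × (∀ j → j < b → ¬ P j)

least : ∀ {P : Pred ℕ 0ℓ} → Decidable P → ∀ a → P a → Least P
least {P} P? = <-rec (λ a → P a → Least P) lower
  where
  lower : ∀ a → (∀ {j} → j < a → P j → Least P) → P a → Least P
  lower a below pa with anyUpTo? P? a
  ... | yes (j , j<a , pj) = below j<a pj
  ... | no none = a , pa , λ j j<a pj → none (j , j<a , pj)

s<i*s : ∀ s i → 1 ≤ s → 2 ≤ i → s < i * s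
s<i*s s (suc zero) _ (s≤s ())
s<i*s s (suc (suc i)) 1≤s _ = m<m+n s (≤-trans 1≤s (m≤m+n s (i * s)))

multiple-bound : ∀ s b r t → b * s ≤ s + (r * s + t) → t < s → b ≤ r + 1
multiple-bound s b r t bs≤ t<s =
  ≤-trans (≤-pred (*-cancelʳ-< s b (suc (suc r)) bs<)) (≤-reflexive (+-comm 1 r))
  where
  open ≤-Reasoning
  bs< : b * s < suc (suc r) * s
  bs< = begin-strict
    b * s            ≤⟨ bs≤ ⟩
    s + (r * s + t)  <⟨ +-monoʳ-< s (+-monoʳ-< (r * s) t<s) ⟩
    s + (r * s + s)  ≡⟨ cong (s +_) (+-comm (r * s) s) ⟩
    suc (suc r) * s  ∎

-- The hypothesis on L forces s < k (so a trade never creates a part k).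
s<k : ∀ s L k → 1 ≤ s → 2 * s ^ 3 + 5 * s ^ 2 + 1 ≤ L → L ≤ k → s < k
s<k s L k 1≤s hL L≤k = begin-strict
  s                        ≡⟨ sym (*-identityʳ s) ⟩
  s * 1                    ≤⟨ *-monoʳ-≤ s (≤-trans 1≤s (≤-reflexive (sym (*-identityʳ s)))) ⟩
  s ^ 2                    ≤⟨ m≤n*m (s ^ 2) 5 ⟩
  5 * s ^ 2                ≤⟨ m≤n+m (5 * s ^ 2) (2 * s ^ 3) ⟩
  2 * s ^ 3 + 5 * s ^ 2    <⟨ m<m+n (2 * s ^ 3 + 5 * s ^ 2) (s≤s z≤n) ⟩
  2 * s ^ 3 + 5 * s ^ 2 + 1 ≤⟨ hL ⟩
  L                        ≤⟨ L≤k ⟩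
  k                        ∎
  where open ≤-Reasoning

InC-no-part-s : ∀ L s n xs → InC L s n xs → mult s xs ≡ 0
InC-no-part-s L s n xs (_ , bounds) =
  mult-absent s xs (All.map (λ (s+1≤x , _) x≡s → <⇒≢ (≤-trans (≤-reflexive (+-comm 1 s)) s+1≤x) (sym x≡s)) bounds)

IsMultiplePart : ℕ → List ℕ → Pred ℕ 0ℓ
IsMultiplePart s xs a = 2 ≤ a × 1 ≤ mult (a * s) xs

isMultiplePart? : ∀ s xs → Decidable (IsMultiplePart s xs)
isMultiplePart? s xs a = (2 ≤? a) ×-dec (1 ≤? mult (a * s) xs)

-- A multiplier b of a partition in C satisfies b·s ≤ s + L ≤ s + k, hence b ≤ r + 1.
multiplier-bound : ∀ L s k n r t xs b → InC L s n xs → L ≤ k → k ≡ r * s + t → t < s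
  → IsMultiplePart s xs b → b ≤ r + 1
multiplier-bound L s k n r t xs b (_ , bounds) L≤k k≡ t<s (_ , b-part) =
  multiple-bound s b r t (subst (λ k′ → b * s ≤ s + k′) k≡ bs≤s+k) t<s
  where
  bs≤s+k : b * s ≤ s + k
  bs≤s+k = ≤-trans (proj₂ (All.lookup bounds (mult-pos⇒∈ (b * s) xs b-part))) (+-monoʳ-≤ s L≤k)

trade-InF1 : ∀ L s k r n xs → 1 ≤ s → s < k → InC L s n xs → mult k xs ≡ 0
  → ((b , _) : Least (IsMultiplePart s xs)) → b ≤ r + 1 → InF1 L s k r n (trade s b xs)
trade-InF1 L s k r n xs 1≤s s<k inC@((desc , sum≡n , _) , bounds) k-absent
  (b , (2≤b , b-part) , below) b≤r+1 =
    ( ( ( trade-descending s b xs desc (All.map (λ (s+1≤x , _) → ≤-trans (m≤m+n s 1) s+1≤x) bounds)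
        , trans (trade-sum s b xs b-part) sum≡n
        , trade-All s b xs (All.map (λ (s+1≤x , _) → ≤-trans (m≤n+m 1 s) s+1≤x) bounds) 1≤s )
      , subst (1 ≤_) (sym g-s) (≤-trans (s≤s z≤n) 2≤b)
      , trade-All s b xs (All.map (λ (s+1≤x , x≤s+L) → ≤-trans (m≤m+n s 1) s+1≤x , x≤s+L) bounds)
          (≤-refl , m≤m+n s L)
      , trade-mult-other s b k xs (<⇒≢ s<k) k-absent )
    , subst (_≤ r + 1) (sym g-s) b≤r+1
    , subst (2 ≤_) (sym g-s) 2≤b
    , gaps )
  where
  g-s : mult s (trade s b xs) ≡ b
  g-s = trade-mult-self s b xs (InC-no-part-s L s n xs inC)
  -- No multiplier below b is a part, and the trade adds no multiple of s.
  gaps : ∀ i → 2 ≤ i → i < mult s (trade s b xs) → mult (i * s) (trade s b xs) ≡ 0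
  gaps i 2≤i i<g = trade-mult-other s b (i * s) xs (<⇒≢ (s<i*s s i 1≤s 2≤i)) is-absent
    where
    is-absent : mult (i * s) xs ≡ 0
    is-absent with mult (i * s) xs in eq
    ... | zero = refl
    ... | suc _ = ⊥-elim (below i (subst (i <_) g-s i<g) (2≤i , subst (1 ≤_) (sym eq) (s≤s z≤n)))

-- Lemma 2.3.  φ₁ trades the least multiplier.

lemma2p3 : (s L k n r t : ℕ) → 1 ≤ s → 2 * s ^ 3 + 5 * s ^ 2 + 1 ≤ L
    → L ≤ k → k ≤ s + L
    → 2 * s ^ 5 + 8 * s ^ 4 + s ^ 3 + 3 * s + 1 ≤ n + 14 * s ^ 2
    → k ≡ r * s + t → t < s
    → Σ (C1 L s k n → F1 L s k r n) λ φ →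
    ∀ x y → proj₁ (φ x) ≡ proj₁ (φ y) → proj₁ x ≡ proj₁ y
lemma2p3 s L k n r t 1≤s hL L≤k _ _ k≡ t<s = φ , φ-injective
  where
  leastMultiplier : (x : C1 L s k n) → Least (IsMultiplePart s (proj₁ x))
  leastMultiplier (xs , _ , _ , (a , a-part)) = least (isMultiplePart? s xs) a a-part

  φ : C1 L s k n → F1 L s k r n
  φ x@(xs , inC , k-absent , _) =
    let m@(b , b-multiplier , _) = leastMultiplier x in
    trade s b xs , trade-InF1 L s k r n xs 1≤s (s<k s L k 1≤s hL L≤k) inC k-absent m
                     (multiplier-bound L s k n r t xs b inC L≤k k≡ t<s b-multiplier)

  φ-injective : ∀ x y → proj₁ (φ x) ≡ proj₁ (φ y) → proj₁ x ≡ proj₁ y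
  φ-injective x@(xs , inC@((dx , _) , _) , _) y@(ys , inC′@((dy , _) , _) , _) =
    trade-injective s (proj₁ (leastMultiplier x)) (proj₁ (leastMultiplier y)) xs ys
      (InC-no-part-s L s n xs inC) (InC-no-part-s L s n ys inC′) dx dy
      (proj₂ (proj₁ (proj₂ (leastMultiplier x)))) (proj₂ (proj₁ (proj₂ (leastMultiplier y))))
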